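{- For every unary context $\Gamma\{\ \}$ and every propositional atom $p$: if $\Gamma\{p,p\}$ is provable in $\mathsf{GLP_{NS}}$, then $\Gamma\{p\}$ is provable in $\mathsf{GLP_{NS}}$.
   Context: Formulas are built from atoms $p$, complements $\overline{p}$, $\top,\bot$, $\wedge,\vee$, and $\Box_i,\Diamond_i$ ($i\in\mathbb{N}$); negation $\overline{A}$ is defined via De Morgan laws, $\overline{\overline{p}}=p$, $\overline{\top}=\bot$, $\overline{\bot}=\top$, $\overline{\Box_iA}=\Diamond_i\overline{A}$, $\overline{\Diamond_iA}=\Box_i\overline{A}$. A nested sequent is (inductively) a finite multiset of formulas and of expressions $[\Delta]_i$ with $\Delta$ a nested sequent and $i\in\mathbb{N}$. A unary context $\Gamma\{\ \}$ is a nested sequent with one hole in place of a formula; $\Gamma\{\Upsilon\}$ fills the hole with $\Upsilon$. $\mathsf{GLP_{NS}}$ has initial sequents $\Gamma\{p,\overline{p}\}$, $\Gamma\{\top\}$ and rules (premises / conclusion): $\Gamma\{A\}$, $\Gamma\{B\}$ / $\Gamma\{A\wedge B\}$; $\Gamma\{A,B\}$ / $\Gamma\{A\vee B\}$; $\Gamma\{[A,\Diamond_i\overline{A}]_i\}$ / $\Gamma\{\Box_iA\}$; $\Gamma\{\Diamond_iA,[A,\Delta]_j\}$ / $\Gamma\{\Diamond_iA,[\Delta]_j\}$ ($i\le j$); $\Gamma\{\Diamond_iA,[\Diamond_iA,\Delta]_j\}$ / $\Gamma\{\Diamond_iA,[\Delta]_j\}$ ($i\le j$); $\Gamma\{\Diamond_iA,[\Diamond_iA,\Delta]_j\}$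 / $\Gamma\{[\Diamond_iA,\Delta]_j\}$ ($i<j$). -}

module Defs where

open import Data.Nat using (ℕ; _≤_; _<_)
open import Data.List using (List; []; _∷_; _++_)

-- Formulas in negation normal form; atoms are indexed by ℕ.
data Fm : Set where
  atom  : ℕ → Fm
  natom : ℕ → Fm
  ⊤f ⊥f : Fm
  _∧f_ _∨f_ : Fm → Fm → Fm
  □ ◇ : ℕ → Fm → Fm

neg : Fm → Fm
neg (atom p)  = natom p
neg (natom p) = atom p
neg ⊤f        = ⊥f
neg ⊥f        = ⊤f
neg (A ∧f B)  = neg A ∨f neg B
neg (A ∨f B)  = neg A ∧f neg B
neg (□ i A)   = ◇ i (neg A)
neg (◇ i A)   = □ i (neg A)

-- Nested sequents: a sequent is a list (read as a multiset, see _~_ and the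
-- exchange rule below) of formulas and bracketed sequents [Δ]_i.
data Item : Set where
  fm  : Fm → Item
  box : ℕ → List Item → Item

Seq : Set
Seq = List Item

mutual
  data _≈ᵢ_ : Item → Item → Set where
    fm≈  : ∀ {A} → fm A ≈ᵢ fm A
    box≈ : ∀ {i Δ Δ'} → Δ ~ Δ' → box i Δ ≈ᵢ box i Δ'

  data _~_ : Seq → Seq → Set where
    []~   : [] ~ []
    prep  : ∀ {x y xs ys} → x ≈ᵢ y → xs ~ ys → (x ∷ xs) ~ (y ∷ ys)
    swap  : ∀ {x y xs} → (x ∷ y ∷ xs) ~ (y ∷ x ∷ xs)
    trans~ : ∀ {xs ys zs} → xs ~ ys → ys ~ zs → xs ~ zs

-- Since sequents are multisets, the hole can be
-- taken to sit at the front of the multiset at its depth: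
--   hole Δ       represents   { }, Δ
--   nest i Γ Δ   represents   [Γ{ }]_i, Δ
data Ctx : Set where
  hole : Seq → Ctx
  nest : ℕ → Ctx → Seq → Ctx

plug : Ctx → Seq → Seq
plug (hole Δ)     Υ = Υ ++ Δ
plug (nest i Γ Δ) Υ = box i (plug Γ Υ) ∷ Δ

data GLP : Seq → Set where
  ax     : ∀ Γ p → GLP (plug Γ (fm (atom p) ∷ fm (natom p) ∷ []))
  ax⊤    : ∀ Γ → GLP (plug Γ (fm ⊤f ∷ []))
  ∧-rule : ∀ Γ A B → GLP (plug Γ (fm A ∷ [])) → GLP (plug Γ (fm B ∷ []))
           → GLP (plug Γ (fm (A ∧f B) ∷ []))
  ∨-rule : ∀ Γ A B → GLP (plug Γ (fm A ∷ fm B ∷ []))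
           → GLP (plug Γ (fm (A ∨f B) ∷ []))
  □-rule : ∀ Γ i A → GLP (plug Γ (box i (fm A ∷ fm (◇ i (neg A)) ∷ []) ∷ []))
           → GLP (plug Γ (fm (□ i A) ∷ []))
  ◇-rule₁ : ∀ Γ i j A Δ → i ≤ j
           → GLP (plug Γ (fm (◇ i A) ∷ box j (fm A ∷ Δ) ∷ []))
           → GLP (plug Γ (fm (◇ i A) ∷ box j Δ ∷ []))
  ◇-rule₂ : ∀ Γ i j A Δ → i ≤ j
           → GLP (plug Γ (fm (◇ i A) ∷ box j (fm (◇ i A) ∷ Δ) ∷ []))
           → GLP (plug Γ (fm (◇ i A) ∷ box j Δ ∷ []))
  ◇-rule₃ : ∀ Γ i j A Δ → i < j
           → GLP (plug Γ (fm (◇ i A) ∷ box j (fm (◇ i A) ∷ Δ) ∷ []))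
           → GLP (plug Γ (box j (fm (◇ i A) ∷ Δ) ∷ []))
  -- sequents are multisets: derivability is invariant under nested permutation
  exch   : ∀ {S S'} → S ~ S' → GLP S → GLP S'

module Submission where

-- We prove a stronger, derivation-local statement.  Call T a p-contraction
-- of S (Contr S T) if T arises from S by deleting one top-level occurrence
-- of the atom p at some node of the nested sequent, while another p
-- remains at that same node.  Call S admissible if every p-contraction of S
-- is derivable.  The main result is that every derivable sequent is
-- admissible, by induction on the derivation:
--   * contractions commute with nested permutations, so exchange is handled;
--   * a contraction of a rule conclusion Γ{X} either lies in the context Γ,
--     or inside a bracket of the principal part X, or deletes a p of X
--     (decomposition lemma 'split');
--   * in each case the same rule, applied to contracted premises, derives
--     the contracted conclusion; only the axiom Γ{p, p̄} can lose its p, and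
--     then the remaining p at that node yields another axiom instance.
-- Since Γ{p,p} contracts to Γ{p}, the theorem follows.

open import Defs
open import Data.Nat using (ℕ; _<_)
open import Data.List using ([]; _∷_; _++_)
open import Data.List.Membership.Propositional using (_∈_)
open import Data.List.Relation.Unary.Any using (here; there)
open import Data.List.Relation.Unary.Any.Properties using (++⁺ʳ; ++⁻)
open import Data.Product using (Σ; _,_; _×_)
open import Data.Sum using (_⊎_; inj₁; inj₂; map₂)
open import Relation.Binary.PropositionalEquality using (_≡_; refl; cong)

mutual
  reflᵢ : ∀ x → x ≈ᵢ x
  reflᵢ (fm A)    = fm≈
  reflᵢ (box i Δ) = box≈ (refl~ Δ)

  refl~ : ∀ xs → xs ~ xs
  refl~ []       = []~
  refl~ (x ∷ xs) = prep (reflᵢ x) (refl~ xs)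

mutual
  symᵢ : ∀ {x y} → x ≈ᵢ y → y ≈ᵢ x
  symᵢ fm≈      = fm≈
  symᵢ (box≈ q) = box≈ (sym~ q)

  sym~ : ∀ {xs ys} → xs ~ ys → ys ~ xs
  sym~ []~          = []~
  sym~ (prep e q)   = prep (symᵢ e) (sym~ q)
  sym~ swap         = swap
  sym~ (trans~ q r) = trans~ (sym~ r) (sym~ q)

module Contraction (p : ℕ) where

  𝐩 : Item
  𝐩 = fm (atom p)

  data Del : Seq → Seq → Set where
    here  : ∀ {S} → Del (𝐩 ∷ S) S
    there : ∀ {x S T} → Del S T → Del (x ∷ S) (x ∷ T)

  mutual
    data Contr : Seq → Seq → Set where
      top  : ∀ {S T} → Del S T → 𝐩 ∈ T → Contr S T
      deep : ∀ {S T} → Deep S T → Contr S T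

    data Deep : Seq → Seq → Set where
      inBox : ∀ {i Δ Δ' S} → Contr Δ Δ' → Deep (box i Δ ∷ S) (box i Δ' ∷ S)
      later : ∀ {x S T} → Deep S T → Deep (x ∷ S) (x ∷ T)

  Admissible : Seq → Set
  Admissible S = ∀ {T} → Contr S T → GLP T

  ∈-resp-~ : ∀ {xs ys} → 𝐩 ∈ xs → xs ~ ys → 𝐩 ∈ ys
  ∈-resp-~ (here refl) (prep fm≈ q)      = here refl
  ∈-resp-~ (there m)   (prep e q)        = there (∈-resp-~ m q)
  ∈-resp-~ (here refl) swap              = there (here refl)
  ∈-resp-~ (there (here refl)) swap      = here refl
  ∈-resp-~ (there (there m)) swap        = there (there m)
  ∈-resp-~ m (trans~ q r)                = ∈-resp-~ (∈-resp-~ m q) r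

  Del-resp-~ : ∀ {S S' T} → Del S T → S ~ S' → Σ Seq (λ T' → Del S' T' × T ~ T')
  Del-resp-~ here (prep fm≈ q) = _ , here , q
  Del-resp-~ (there r) (prep e q) with Del-resp-~ r q
  ... | T' , r' , q' = _ , there r' , prep e q'
  Del-resp-~ {T = T} here swap         = _ , there here , refl~ T
  Del-resp-~ {T = T} (there here) swap = _ , here , refl~ T
  Del-resp-~ (there (there r)) swap    = _ , there (there r) , swap
  Del-resp-~ r (trans~ q₁ q₂) with Del-resp-~ r q₁
  ... | T₁ , r₁ , e₁ with Del-resp-~ r₁ q₂
  ... | T₂ , r₂ , e₂ = T₂ , r₂ , trans~ e₁ e₂

  mutual
    Contr-resp-~ : ∀ {S S' T} → Contr S T → S ~ S' → Σ Seq (λ T' → Contr S' T' × T ~ T')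
    Contr-resp-~ (top r m) q with Del-resp-~ r q
    ... | T' , r' , q' = T' , top r' (∈-resp-~ m q') , q'
    Contr-resp-~ (deep d) q with Deep-resp-~ d q
    ... | T' , d' , q' = T' , deep d' , q'

    Deep-resp-~ : ∀ {S S' T} → Deep S T → S ~ S' → Σ Seq (λ T' → Deep S' T' × T ~ T')
    Deep-resp-~ (inBox c) (prep (box≈ e) q) with Contr-resp-~ c e
    ... | Δ' , c' , e' = _ , inBox c' , prep (box≈ e') q
    Deep-resp-~ (later d) (prep e q) with Deep-resp-~ d q
    ... | T' , d' , q' = _ , later d' , prep e q'
    Deep-resp-~ (inBox c) swap         = _ , later (inBox c) , swap
    Deep-resp-~ (later (inBox c)) swap = _ , inBox c , swap
    Deep-resp-~ (later (later d)) swap = _ , later (later d) , swap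
    Deep-resp-~ d (trans~ q₁ q₂) with Deep-resp-~ d q₁
    ... | T₁ , d₁ , e₁ with Deep-resp-~ d₁ q₂
    ... | T₂ , d₂ , e₂ = T₂ , d₂ , trans~ e₁ e₂

  Admissible-resp-~ : ∀ {S S'} → S ~ S' → Admissible S → Admissible S'
  Admissible-resp-~ s ih c with Contr-resp-~ c (sym~ s)
  ... | T' , c' , q = exch (sym~ q) (ih c')

  Del-++ˡ : ∀ Y {Δ Δ'} → Del Δ Δ' → Del (Y ++ Δ) (Y ++ Δ')
  Del-++ˡ []      r = r
  Del-++ˡ (y ∷ Y) r = there (Del-++ˡ Y r)

  Deep-++ˡ : ∀ Y {Δ Δ'} → Deep Δ Δ' → Deep (Y ++ Δ) (Y ++ Δ')
  Deep-++ˡ []      d = d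
  Deep-++ˡ (y ∷ Y) d = later (Deep-++ˡ Y d)

  Deep-++ʳ : ∀ {Y Y'} Δ → Deep Y Y' → Deep (Y ++ Δ) (Y' ++ Δ)
  Deep-++ʳ Δ (inBox c) = inBox c
  Deep-++ʳ Δ (later d) = later (Deep-++ʳ Δ d)

  Deep-plug : ∀ Γ {Y Y'} → Deep Y Y' → Deep (plug Γ Y) (plug Γ Y')
  Deep-plug (hole Δ)     d = Deep-++ʳ Δ d
  Deep-plug (nest i Γ Δ) d = inBox (deep (Deep-plug Γ d))

  Contr-cons : ∀ {x Δ Δ'} → Contr Δ Δ' → Contr (x ∷ Δ) (x ∷ Δ')
  Contr-cons (top r m) = top (there r) (there m)
  Contr-cons (deep d)  = deep (later d)

  data CtxContr : Ctx → Ctx → Set where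
    holeTop  : ∀ {Δ Δ'} → Del Δ Δ' → 𝐩 ∈ Δ' → CtxContr (hole Δ) (hole Δ')
    holeDeep : ∀ {Δ Δ'} → Deep Δ Δ' → CtxContr (hole Δ) (hole Δ')
    inside   : ∀ {i Γ Γ' Δ} → CtxContr Γ Γ' → CtxContr (nest i Γ Δ) (nest i Γ' Δ)
    nestTop  : ∀ {i Γ Δ Δ'} → Del Δ Δ' → 𝐩 ∈ Δ' → CtxContr (nest i Γ Δ) (nest i Γ Δ')
    nestDeep : ∀ {i Γ Δ Δ'} → Deep Δ Δ' → CtxContr (nest i Γ Δ) (nest i Γ Δ')

  Contr-plug : ∀ {Γ Γ'} → CtxContr Γ Γ' → ∀ Y → Contr (plug Γ Y) (plug Γ' Y)
  Contr-plug (holeTop r m) Y = top (Del-++ˡ Y r) (++⁺ʳ Y m)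
  Contr-plug (holeDeep d)  Y = deep (Deep-++ˡ Y d)
  Contr-plug (inside cc)   Y = deep (inBox (Contr-plug cc Y))
  Contr-plug (nestTop r m) Y = top (there r) (there m)
  Contr-plug (nestDeep d)  Y = deep (later d)

  Del-split : ∀ X {Δ T} → Del (X ++ Δ) T
    → Σ Seq (λ X' → Del X X' × T ≡ X' ++ Δ) ⊎ Σ Seq (λ Δ' → Del Δ Δ' × T ≡ X ++ Δ')
  Del-split []      r = inj₂ (_ , r , refl)
  Del-split (x ∷ X) here = inj₁ (_ , here , refl)
  Del-split (x ∷ X) (there r) with Del-split X r
  ... | inj₁ (X' , r' , refl) = inj₁ (_ , there r' , refl)
  ... | inj₂ (Δ' , r' , refl) = inj₂ (_ , r' , refl)

  Deep-split : ∀ X {Δ T} → Deep (X ++ Δ) T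
    → Σ Seq (λ X' → Deep X X' × T ≡ X' ++ Δ) ⊎ Σ Seq (λ Δ' → Deep Δ Δ' × T ≡ X ++ Δ')
  Deep-split []      d = inj₂ (_ , d , refl)
  Deep-split (x ∷ X) (inBox c) = inj₁ (_ , inBox c , refl)
  Deep-split (x ∷ X) (later d) with Deep-split X d
  ... | inj₁ (X' , d' , refl) = inj₁ (_ , later d' , refl)
  ... | inj₂ (Δ' , d' , refl) = inj₂ (_ , d' , refl)

  holeLevel : Ctx → Seq
  holeLevel (hole Δ)     = Δ
  holeLevel (nest i Γ Δ) = holeLevel Γ

  -- In the context case the
  -- surviving p lies either in X or in the context (then the contraction is
  -- a context contraction); when a p of X is deleted, a p survives at the
  -- hole's node.
  data Split (Γ : Ctx) (X T : Seq) : Set where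
    inContext   : ∀ Γ' → T ≡ plug Γ' X → 𝐩 ∈ X ⊎ CtxContr Γ Γ' → Split Γ X T
    inBracket   : ∀ X' → Deep X X' → T ≡ plug Γ X' → Split Γ X T
    atPrincipal : ∀ X' → Del X X' → T ≡ plug Γ X' → 𝐩 ∈ (X' ++ holeLevel Γ)
                → Split Γ X T

  split : ∀ Γ {X T} → Contr (plug Γ X) T → Split Γ X T
  split (hole Δ) {X} (top r m) with Del-split X r
  ... | inj₁ (X' , r' , refl) = atPrincipal X' r' refl m
  ... | inj₂ (Δ' , r' , refl) = inContext (hole Δ') refl (map₂ (holeTop r') (++⁻ X m))
  split (hole Δ) {X} (deep d) with Deep-split X d
  ... | inj₁ (X' , d' , refl) = inBracket X' d' refl
  ... | inj₂ (Δ' , d' , refl) = inContext (hole Δ') refl (inj₂ (holeDeep d'))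
  split (nest i Γ Δ) (top (there r) (there m)) = inContext (nest i Γ _) refl (inj₂ (nestTop r m))
  split (nest i Γ Δ) (deep (later d)) = inContext (nest i Γ _) refl (inj₂ (nestDeep d))
  split (nest i Γ Δ) (deep (inBox c)) with split Γ c
  ... | inContext Γ' eq h       = inContext (nest i Γ' Δ) (cong (λ z → box i z ∷ Δ) eq) (map₂ inside h)
  ... | inBracket X' d eq       = inBracket X' d (cong (λ z → box i z ∷ Δ) eq)
  ... | atPrincipal X' r eq m   = atPrincipal X' r (cong (λ z → box i z ∷ Δ) eq) m

  extract : ∀ {Δ} → 𝐩 ∈ Δ → Σ Seq (λ Δ₀ → Δ ~ (𝐩 ∷ Δ₀))
  extract {𝐩 ∷ S} (here refl) = S , refl~ (𝐩 ∷ S)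
  extract {x ∷ S} (there m) with extract m
  ... | Δ₀ , q = x ∷ Δ₀ , trans~ (prep (reflᵢ x) q) swap

  axiom-at-hole : ∀ Γ → 𝐩 ∈ holeLevel Γ
    → Σ Ctx (λ Γ₀ → plug Γ₀ (𝐩 ∷ fm (natom p) ∷ []) ~ plug Γ (fm (natom p) ∷ []))
  axiom-at-hole (hole Δ) m with extract m
  ... | Δ₀ , q = hole Δ₀ , trans~ swap (prep fm≈ (sym~ q))
  axiom-at-hole (nest i Γ Δ) m with axiom-at-hole Γ m
  ... | Γ₀ , q = nest i Γ₀ Δ , prep (box≈ q) (refl~ Δ)

  Contr-uncons-◇ : ∀ {i A Δ T} → Contr (fm (◇ i A) ∷ Δ) T
                 → Σ Seq (λ Δ' → T ≡ fm (◇ i A) ∷ Δ' × Contr Δ Δ')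
  Contr-uncons-◇ (top (there r) (there m)) = _ , refl , top r m
  Contr-uncons-◇ (deep (later d))          = _ , refl , deep d

  ax-admissible : ∀ Γ q → Admissible (plug Γ (fm (atom q) ∷ fm (natom q) ∷ []))
  ax-admissible Γ q c with split Γ c
  ... | inContext Γ' refl _ = ax Γ' q
  ... | inBracket _ (later (later ())) _
  ... | atPrincipal _ (there (there ())) _ _
  ... | atPrincipal _ here refl (there m) with axiom-at-hole Γ m
  ... | Γ₀ , e = exch e (ax Γ₀ p)

  ax⊤-admissible : ∀ Γ → Admissible (plug Γ (fm ⊤f ∷ []))
  ax⊤-admissible Γ c with split Γ c
  ... | inContext Γ' refl _ = ax⊤ Γ'
  ... | inBracket _ (later ()) _
  ... | atPrincipal _ (there ()) _ _

  ∧-admissible : ∀ Γ A B → Admissible (plug Γ (fm A ∷ [])) → Admissible (plug Γ (fm B ∷ []))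
               → Admissible (plug Γ (fm (A ∧f B) ∷ []))
  ∧-admissible Γ A B ih₁ ih₂ c with split Γ c
  ... | inContext Γ' refl (inj₁ (there ()))
  ... | inContext Γ' refl (inj₂ cc) = ∧-rule Γ' A B (ih₁ (Contr-plug cc _)) (ih₂ (Contr-plug cc _))
  ... | inBracket _ (later ()) _
  ... | atPrincipal _ (there ()) _ _

  ∨-admissible : ∀ Γ A B → Admissible (plug Γ (fm A ∷ fm B ∷ []))
               → Admissible (plug Γ (fm (A ∨f B) ∷ []))
  ∨-admissible Γ A B ih c with split Γ c
  ... | inContext Γ' refl (inj₁ (there ()))
  ... | inContext Γ' refl (inj₂ cc) = ∨-rule Γ' A B (ih (Contr-plug cc _))
  ... | inBracket _ (later ()) _
  ... | atPrincipal _ (there ()) _ _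

  □-admissible : ∀ Γ i A → Admissible (plug Γ (box i (fm A ∷ fm (◇ i (neg A)) ∷ []) ∷ []))
               → Admissible (plug Γ (fm (□ i A) ∷ []))
  □-admissible Γ i A ih c with split Γ c
  ... | inContext Γ' refl (inj₁ (there ()))
  ... | inContext Γ' refl (inj₂ cc) = □-rule Γ' i A (ih (Contr-plug cc _))
  ... | inBracket _ (later ()) _
  ... | atPrincipal _ (there ()) _ _

  -- The premise of ◇-rule₁ and ◇-rule₂ adds one formula B to the bracket.
  ◇-pattern : ∀ Γ i j A B Δ
    → (∀ Γ' Δ' → GLP (plug Γ' (fm (◇ i A) ∷ box j (B ∷ Δ') ∷ []))
               → GLP (plug Γ' (fm (◇ i A) ∷ box j Δ' ∷ [])))
    → Admissible (plug Γ (fm (◇ i A) ∷ box j (B ∷ Δ) ∷ []))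
    → Admissible (plug Γ (fm (◇ i A) ∷ box j Δ ∷ []))
  ◇-pattern Γ i j A B Δ rule ih c with split Γ c
  ... | inContext Γ' refl (inj₁ (there (there ())))
  ... | inContext Γ' refl (inj₂ cc) = rule Γ' Δ (ih (Contr-plug cc _))
  ... | inBracket _ (later (inBox c')) refl =
        rule Γ _ (ih (deep (Deep-plug Γ (later (inBox (Contr-cons c'))))))
  ... | inBracket _ (later (later ())) _
  ... | atPrincipal _ (there (there ())) _ _

  ◇₃-admissible : ∀ Γ i j A Δ → i < j
    → Admissible (plug Γ (fm (◇ i A) ∷ box j (fm (◇ i A) ∷ Δ) ∷ []))
    → Admissible (plug Γ (box j (fm (◇ i A) ∷ Δ) ∷ []))
  ◇₃-admissible Γ i j A Δ lt ih c with split Γ c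
  ... | inContext Γ' refl (inj₁ (there ()))
  ... | inContext Γ' refl (inj₂ cc) = ◇-rule₃ Γ' i j A Δ lt (ih (Contr-plug cc _))
  ... | inBracket _ (later ()) _
  ... | atPrincipal _ (there ()) _ _
  ... | inBracket _ (inBox c') refl with Contr-uncons-◇ c'
  ... | Δ' , refl , c'' =
        ◇-rule₃ Γ i j A Δ' lt (ih (deep (Deep-plug Γ (later (inBox (Contr-cons c''))))))

  admissible : ∀ {S} → GLP S → Admissible S
  admissible (ax Γ q)                    = ax-admissible Γ q
  admissible (ax⊤ Γ)                     = ax⊤-admissible Γ
  admissible (∧-rule Γ A B d₁ d₂)        = ∧-admissible Γ A B (admissible d₁) (admissible d₂)
  admissible (∨-rule Γ A B d)            = ∨-admissible Γ A B (admissible d)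
  admissible (□-rule Γ i A d)            = □-admissible Γ i A (admissible d)
  admissible (◇-rule₁ Γ i j A Δ le d)    =
    ◇-pattern Γ i j A (fm A) Δ (λ Γ' Δ' → ◇-rule₁ Γ' i j A Δ' le) (admissible d)
  admissible (◇-rule₂ Γ i j A Δ le d)    =
    ◇-pattern Γ i j A (fm (◇ i A)) Δ (λ Γ' Δ' → ◇-rule₂ Γ' i j A Δ' le) (admissible d)
  admissible (◇-rule₃ Γ i j A Δ lt d)    = ◇₃-admissible Γ i j A Δ lt (admissible d)
  admissible (exch s d)                  = Admissible-resp-~ s (admissible d)

  contract-pair : ∀ Γ → Contr (plug Γ (𝐩 ∷ 𝐩 ∷ [])) (plug Γ (𝐩 ∷ []))
  contract-pair (hole Δ)     = top here (here refl)
  contract-pair (nest i Γ Δ) = deep (inBox (contract-pair Γ))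

lemma6 : (Γ : Ctx) (p : ℕ)
    → GLP (plug Γ (fm (atom p) ∷ fm (atom p) ∷ []))
    → GLP (plug Γ (fm (atom p) ∷ []))
lemma6 Γ p d = admissible d (contract-pair Γ)
  where open Contraction p
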